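{- Let $\mathcal{C}$ be a $(v_r,b_k)$ configuration with $r>2$ (and $k\ge 2$, $v\ge 4$, $b\ge 4$). Then for every field $\mathbf F$, the well-covered dimension of the Levi graph of $\mathcal{C}$ is $0$, i.e. $wcdim(Levi_{\mathcal{C}},\mathbf F)=0$.
   Context: A configuration is an incidence structure consisting of a set of points and a set of lines together with an incidence relation between points and lines, such that any two distinct points are incident with at most one common line and any two distinct lines are incident with at most one common point. A $(v_r,b_k)$ configuration is a configuration with exactly $v\ge 4$ points and exactly $b\ge 4$ lines, in which every line is incident with exactly $k\ge 2$ points and every point is incident with exactly $r\ge 2$ lines. The Levi graph $Levi_{\mathcal{C}}$ of a configuration $\mathcal{C}$ is the simple bipartite graph whose vertex set is the disjoint union of the points and the lines of $\mathcal{C}$, with a point-vertex $P$ adjacent to a line-vertex $\ell$ iff $P$ is incident with $\ell$, and no other edges. For a graph $G$ and a field $\mathbf F$, a weighting $f:V(G)\to\mathbf F$ is well-covered if $\sum_{x\in M} f(x)$ takes the same value for every maximal independent set $M$ of $G$; the well-covered weightings form an $\mathbf F$-vector space, the well-covered space, whose dimension is the well-covered dimension $wcdim(G,\mathbf F)$. -}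

module Defs where

open import Level using (Level; _⊔_; suc)
open import Data.Nat using (ℕ; _≤_; _>_)
open import Data.Bool using (Bool; true; false; if_then_else_; T)
open import Data.Fin using (Fin)
open import Data.List using (List; filter; length)
open import Data.List using () renaming (allFin to allFinL)
open import Data.Sum using (_⊎_; inj₁; inj₂)
open import Data.Product using (Σ; ∃; _×_; _,_)
open import Relation.Nullary using (¬_)
open import Relation.Binary.PropositionalEquality using (_≡_; _≢_)
open import Algebra.Bundles using (CommutativeRing)
open import Data.Bool.Properties using (T?)

record Field (c ℓ : Level) : Set (Level.suc (c ⊔ ℓ)) where
  field
    commutativeRing : CommutativeRing c ℓ
  open CommutativeRing commutativeRing public
  field
    1≉0     : ¬ (1# ≈ 0#)
    inverse : ∀ x → ¬ (x ≈ 0#) → ∃ λ y → x * y ≈ 1#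

countFin : ∀ {n} → (Fin n → Bool) → ℕ
countFin {n} p = length (filter (λ i → T? (p i)) (allFinL n))

record Configuration (v b r k : ℕ) : Set where
  field
    incident : Fin v → Fin b → Bool
    line-size  : ∀ (ℓ : Fin b) → countFin (λ P → incident P ℓ) ≡ k
    point-deg  : ∀ (P : Fin v) → countFin (λ ℓ → incident P ℓ) ≡ r
    points-one-line : ∀ (P Q : Fin v) (ℓ m : Fin b) → P ≢ Q →
      T (incident P ℓ) → T (incident Q ℓ) →
      T (incident P m) → T (incident Q m) → ℓ ≡ m
    lines-one-point : ∀ (ℓ m : Fin b) (P Q : Fin v) → ℓ ≢ m →
      T (incident P ℓ) → T (incident P m) →
      T (incident Q ℓ) → T (incident Q m) → P ≡ Q

record Graph (V : Set) : Set₁ where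
  field
    Adj : V → V → Set

LeviVertex : ℕ → ℕ → Set
LeviVertex v b = Fin v ⊎ Fin b

LeviAdj : ∀ {v b r k} → Configuration v b r k →
          LeviVertex v b → LeviVertex v b → Set
LeviAdj C (inj₁ P) (inj₂ ℓ) = T (Configuration.incident C P ℓ)
LeviAdj C (inj₂ ℓ) (inj₁ P) = T (Configuration.incident C P ℓ)
LeviAdj C (inj₁ _) (inj₁ _) = Data.Empty.⊥ where import Data.Empty
LeviAdj C (inj₂ _) (inj₂ _) = Data.Empty.⊥ where import Data.Empty

Levi : ∀ {v b r k} → Configuration v b r k → Graph (LeviVertex v b)
Levi C = record { Adj = LeviAdj C }

module _ {V : Set} (G : Graph V) where
  open Graph G

  Independent : (V → Bool) → Set
  Independent S = ∀ x y → T (S x) → T (S y) → ¬ Adj x y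

  _⊆ₛ_ : (V → Bool) → (V → Bool) → Set
  S ⊆ₛ S' = ∀ x → T (S x) → T (S' x)

  MaximalIndependent : (V → Bool) → Set
  MaximalIndependent S =
    Independent S × (∀ S' → Independent S' → S ⊆ₛ S' → S' ⊆ₛ S)

module _ {c ℓ : Level} (F : Field c ℓ) where
  open Field F

  sumFin : ∀ {n} → (Fin n → Carrier) → Carrier
  sumFin {ℕ.zero}  f = 0#
  sumFin {ℕ.suc n} f = f Fin.zero + sumFin (λ i → f (Fin.suc i))

  weightLevi : ∀ {v b} → (LeviVertex v b → Carrier) →
               (LeviVertex v b → Bool) → Carrier
  weightLevi f S =
    sumFin (λ P → if S (inj₁ P) then f (inj₁ P) else 0#) +
    sumFin (λ l → if S (inj₂ l) then f (inj₂ l) else 0#)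

  WellCoveredLevi : ∀ {v b r k} → Configuration v b r k →
                    (LeviVertex v b → Carrier) → Set _
  WellCoveredLevi C f = ∀ M M' →
    MaximalIndependent (Levi C) M → MaximalIndependent (Levi C) M' →
    weightLevi f M ≈ weightLevi f M'

  -- wcdim(Levi C, F) = 0 : the well-covered space is the zero subspace,
  -- i.e. every well-covered weighting is identically zero.
  WcdimZeroLevi : ∀ {v b r k} → Configuration v b r k → Set _
  WcdimZeroLevi {v} {b} C =
    ∀ (f : LeviVertex v b → Carrier) → WellCoveredLevi C f →
      ∀ x → f x ≈ 0#

module Submission where

-- Compare the weights of three kinds of maximal independent sets of the Levi
-- graph: all lines; a point P with the lines missing P; two points P, Q with
-- the lines missing both.  The last is maximal because any other point lies on
-- r ≥ 3 lines, at most one through P and at most one through Q.  Equating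
-- weights gives f(P) = Σ_{ℓ ∋ P} f(ℓ) and f(Q) = Σ_{ℓ ∋ Q, ℓ ∌ P} f(ℓ).  For
-- two points P, Q of a line ℓ the difference of these two sums (taken at Q) is
-- the sum over lines through both P and Q, i.e. f(ℓ) alone; so f vanishes on
-- lines, and then on points by the first identity.

open import Defs
open import Level using (Level)
open import Data.Nat as ℕ using (ℕ; zero; suc; _≤_; _<_; z≤n; s≤s)
open import Data.Nat.Properties using (≤-trans; ≤-reflexive; module ≤-Reasoning; ≤-pred; <⇒≤; m≤n⇒m≤1+n; +-suc; +-mono-≤)
open import Data.Bool using (Bool; true; false; if_then_else_; T; not; _∧_; _∨_)
open import Data.Bool.Properties using (T?; ∧-comm; ∧-distribˡ-∨)
open import Data.Empty using (⊥-elim)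
open import Data.Fin as Fin using (Fin; _≟_; punchIn)
open import Data.Fin.Properties using (0≢1+n; suc-injective; punchInᵢ≢i)
open import Data.List using (filter; length; tabulate)
open import Data.Sum using (_⊎_; inj₁; inj₂; [_,_]′)
open import Data.Product using (∃; ∃₂; _×_; _,_; proj₂)
open import Function using (_∘_; const)
open import Relation.Nullary using (¬_; yes; no)
open import Relation.Nullary.Decidable using (⌊_⌋; toWitness; fromWitness; toWitnessFalse)
open import Relation.Binary.PropositionalEquality as ≡ using (_≡_; _≢_)
open import Algebra.Bundles using (CommutativeMonoid)
import Algebra.Properties.CommutativeMonoid.Sum as MonoidSum
import Algebra.Properties.Group as GroupProperties
import Relation.Binary.Reasoning.Setoid as SetoidReasoning

T-not⇒¬T : ∀ {a} → T (not a) → ¬ T a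
T-not⇒¬T {true} ()

¬T-not⇒T : ∀ {a} → ¬ T (not a) → T a
¬T-not⇒T {true}  _  = _
¬T-not⇒T {false} ¬t = ¬t _

T-∧⁻ : ∀ a {c} → T (a ∧ c) → T a × T c
T-∧⁻ true t = _ , t

T-∧⁺ : ∀ {a c} → T a → T c → T (a ∧ c)
T-∧⁺ {true} _ t = t

T-∨⁻ : ∀ a {c} → T (a ∨ c) → T a ⊎ T c
T-∨⁻ true  t = inj₁ t
T-∨⁻ false t = inj₂ t

T-∨⁺ˡ : ∀ {a} c → T a → T (a ∨ c)
T-∨⁺ˡ {true} c _ = _

T-∨⁺ʳ : ∀ a {c} → T c → T (a ∨ c)
T-∨⁺ʳ true  _ = _
T-∨⁺ʳ false t = t

not-∨ : ∀ a c → not (a ∨ c) ≡ not a ∧ not c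
not-∨ true  c = ≡.refl
not-∨ false c = ≡.refl

count : ∀ {n} → (Fin n → Bool) → ℕ
count {zero}  p = 0
count {suc n} p = if p Fin.zero then suc (count (p ∘ Fin.suc)) else count (p ∘ Fin.suc)

count-tabulate : ∀ {A : Set} {n} (p : A → Bool) (f : Fin n → A) →
  length (filter (T? ∘ p) (tabulate f)) ≡ count (p ∘ f)
count-tabulate {n = zero}  p f = ≡.refl
count-tabulate {n = suc n} p f with p (f Fin.zero)
... | true  = ≡.cong suc (count-tabulate p (f ∘ Fin.suc))
... | false = count-tabulate p (f ∘ Fin.suc)

countFin≡count : ∀ {n} (p : Fin n → Bool) → countFin p ≡ count p
countFin≡count p = count-tabulate p (λ i → i)

count-cong : ∀ {n} {p q : Fin n → Bool} → (∀ i → p i ≡ q i) → count p ≡ count q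
count-cong {zero}          eq = ≡.refl
count-cong {suc n} {p} {q} eq rewrite eq Fin.zero
  = ≡.cong (λ c → if q Fin.zero then suc c else c) (count-cong (eq ∘ Fin.suc))

count-none : ∀ {n} {p : Fin n → Bool} → (∀ i → ¬ T (p i)) → count p ≡ 0
count-none {zero}      none = ≡.refl
count-none {suc n} {p} none with p Fin.zero in eq
... | true  = ⊥-elim (none Fin.zero (≡.subst T (≡.sym eq) _))
... | false = count-none (none ∘ Fin.suc)

count-≤1 : ∀ {n} {p : Fin n → Bool} → (∀ i j → T (p i) → T (p j) → i ≡ j) → count p ≤ 1
count-≤1 {zero}      unique = z≤n
count-≤1 {suc n} {p} unique with p Fin.zero in eq
... | true  = s≤s (≤-reflexive (count-none {p = p ∘ Fin.suc} λ i pi →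
                  0≢1+n (unique _ _ (≡.subst T (≡.sym eq) _) pi)))
... | false = count-≤1 (λ i j pi pj → suc-injective (unique _ _ pi pj))

count-∨ : ∀ {n} (p q : Fin n → Bool) → count (λ i → p i ∨ q i) ≤ count p ℕ.+ count q
count-∨ {zero}  p q = z≤n
count-∨ {suc n} p q with p Fin.zero | q Fin.zero | count-∨ (p ∘ Fin.suc) (q ∘ Fin.suc)
... | true  | true  | ih = s≤s (≤-trans (m≤n⇒m≤1+n ih) (≤-reflexive (≡.sym (+-suc _ _))))
... | true  | false | ih = s≤s ih
... | false | true  | ih = ≤-trans (s≤s ih) (≤-reflexive (≡.sym (+-suc _ _)))
... | false | false | ih = ih

∃-of-count : ∀ {n} {p : Fin n → Bool} → 0 < count p → ∃ λ i → T (p i)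
∃-of-count {suc n} {p} pos with p Fin.zero in eq
... | true  = Fin.zero , ≡.subst T (≡.sym eq) _
... | false = let i , pi = ∃-of-count pos in Fin.suc i , pi

∃-not-of-count : ∀ {n} (p q : Fin n → Bool) → count (λ i → p i ∧ q i) < count p →
  ∃ λ i → T (p i) × T (not (q i))
∃-not-of-count {suc n} p q lt with p Fin.zero in eqp | q Fin.zero in eqq
... | true  | false = Fin.zero , ≡.subst T (≡.sym eqp) _ , ≡.subst (T ∘ not) (≡.sym eqq) _
... | true  | true  = let i , pi , qi = ∃-not-of-count (p ∘ Fin.suc) (q ∘ Fin.suc) (≤-pred lt) in
                      Fin.suc i , pi , qi
... | false | _     = let i , pi , qi = ∃-not-of-count (p ∘ Fin.suc) (q ∘ Fin.suc) lt in
                      Fin.suc i , pi , qi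

module Selection {a ℓ} (M : CommutativeMonoid a ℓ) where
  open CommutativeMonoid M renaming (_∙_ to _+_; ε to 0#; ∙-cong to +-cong)
  open MonoidSum M
  open SetoidReasoning setoid

  sel : Bool → Carrier → Carrier
  sel c x = if c then x else 0#

  sel-T : ∀ {c} x → T c → sel c x ≈ x
  sel-T {true} x _ = refl

  sel-¬T : ∀ {c} x → ¬ T c → sel c x ≈ 0#
  sel-¬T {true}  x ¬c = ⊥-elim (¬c _)
  sel-¬T {false} x _  = refl

  sel-zero : ∀ c {x} → x ≈ 0# → sel c x ≈ 0#
  sel-zero true  x≈0 = x≈0
  sel-zero false _   = refl

  sel-split : ∀ a c x → sel a x ≈ sel (a ∧ c) x + sel (a ∧ not c) x
  sel-split false c     x = sym (identityˡ 0#)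
  sel-split true  true  x = sym (identityʳ x)
  sel-split true  false x = sym (identityˡ x)

  sel-∨ : ∀ a c x → ¬ (T a × T c) → sel (a ∨ c) x ≈ sel a x + sel c x
  sel-∨ true  true  x disjoint = ⊥-elim (disjoint (_ , _))
  sel-∨ true  false x _        = sym (identityʳ x)
  sel-∨ false c     x _        = sym (identityˡ _)

  ∑-zero : ∀ {n} {f : Fin n → Carrier} → (∀ i → f i ≈ 0#) → sum f ≈ 0#
  ∑-zero {n} f≈0 = trans (sum-cong-≋ {n} f≈0) (sum-replicate-zero n)

  ∑-sel-split : ∀ {n} (p q : Fin n → Bool) (f : Fin n → Carrier) →
    sum (λ i → sel (p i) (f i)) ≈
    sum (λ i → sel (p i ∧ q i) (f i)) + sum (λ i → sel (p i ∧ not (q i)) (f i))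
  ∑-sel-split p q f = trans (sum-cong-≋ (λ i → sel-split (p i) (q i) (f i)))
    (∑-distrib-+ (λ i → sel (p i ∧ q i) (f i)) (λ i → sel (p i ∧ not (q i)) (f i)))

  ∑-sel-unique : ∀ {n} {p : Fin n → Bool} {j} (f : Fin n → Carrier) →
    T (p j) → (∀ i → T (p i) → i ≡ j) → sum (λ i → sel (p i) (f i)) ≈ f j
  ∑-sel-unique {suc n} {p} {j} f pj unique = begin
    sum (λ i → sel (p i) (f i))
      ≈⟨ sum-remove {i = j} (λ i → sel (p i) (f i)) ⟩
    sel (p j) (f j) + sum (λ i → sel (p (punchIn j i)) (f (punchIn j i)))
      ≈⟨ +-cong (sel-T (f j) pj) (∑-zero away) ⟩
    f j + 0#
      ≈⟨ identityʳ (f j) ⟩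
    f j ∎
    where
      away : ∀ i → sel (p (punchIn j i)) (f (punchIn j i)) ≈ 0#
      away i = sel-¬T _ (λ pi → punchInᵢ≢i j i (unique _ pi))

module _ {V : Set} (G : Graph V) where
  open Graph G

  Dominating : (V → Bool) → Set
  Dominating S = ∀ x → ¬ T (S x) → ∃ λ y → T (S y) × Adj x y

  independent∧dominating⇒maximal : ∀ {S} → Independent G S → Dominating S →
    MaximalIndependent G S
  independent∧dominating⇒maximal {S} indep dom = indep , maximal
    where
      maximal : ∀ S' → Independent G S' → _⊆ₛ_ G S S' → _⊆ₛ_ G S' S
      maximal S' indep' S⊆S' x x∈S' with T? (S x)
      ... | yes x∈S = x∈S
      ... | no  x∉S = let y , y∈S , x~y = dom x x∉S in
                      ⊥-elim (indep' x y x∈S' (S⊆S' y y∈S) x~y)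

module LeviGraph {v b r k} (C : Configuration v b r k) where
  open Configuration C

  levi-maximal : (sp : Fin v → Bool) (sl : Fin b → Bool) →
    (∀ P ℓ → T (sp P) → T (sl ℓ) → ¬ T (incident P ℓ)) →
    (∀ P → ¬ T (sp P) → ∃ λ ℓ → T (sl ℓ) × T (incident P ℓ)) →
    (∀ ℓ → ¬ T (sl ℓ) → ∃ λ P → T (sp P) × T (incident P ℓ)) →
    MaximalIndependent (Levi C) [ sp , sl ]′
  levi-maximal sp sl indep pointDom lineDom =
    independent∧dominating⇒maximal (Levi C) independent dominating
    where
      independent : Independent (Levi C) [ sp , sl ]′
      independent (inj₁ P) (inj₂ ℓ) P∈ ℓ∈ = indep P ℓ P∈ ℓ∈
      independent (inj₂ ℓ) (inj₁ P) ℓ∈ P∈ = indep P ℓ P∈ ℓ∈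
      independent (inj₁ _) (inj₁ _) _ _ ()
      independent (inj₂ _) (inj₂ _) _ _ ()
      dominating : Dominating (Levi C) [ sp , sl ]′
      dominating (inj₁ P) P∉ = let ℓ , ℓ∈ , Pℓ = pointDom P P∉ in inj₂ ℓ , ℓ∈ , Pℓ
      dominating (inj₂ ℓ) ℓ∉ = let P , P∈ , Pℓ = lineDom ℓ ℓ∉ in inj₁ P , P∈ , Pℓ

  count-lines-through : ∀ P → count (incident P) ≡ r
  count-lines-through P = ≡.trans (≡.sym (countFin≡count (incident P))) (point-deg P)

  count-points-on : ∀ ℓ → count (λ P → incident P ℓ) ≡ k
  count-points-on ℓ = ≡.trans (≡.sym (countFin≡count (λ P → incident P ℓ))) (line-size ℓ)

  count-common-lines≤1 : ∀ {P Q} → P ≢ Q → count (λ ℓ → incident P ℓ ∧ incident Q ℓ) ≤ 1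
  count-common-lines≤1 {P} {Q} P≢Q = count-≤1 λ ℓ m PQℓ PQm →
    let Pℓ , Qℓ = T-∧⁻ (incident P ℓ) PQℓ
        Pm , Qm = T-∧⁻ (incident P m) PQm
    in points-one-line P Q ℓ m P≢Q Pℓ Qℓ Pm Qm

  line-through : 0 < r → ∀ P → ∃ λ ℓ → T (incident P ℓ)
  line-through 0<r P = ∃-of-count (≡.subst (0 <_) (≡.sym (count-lines-through P)) 0<r)

  line-through-avoiding : 1 < r → ∀ {P Q} → P ≢ Q →
    ∃ λ ℓ → T (incident P ℓ) × T (not (incident Q ℓ))
  line-through-avoiding 1<r {P} {Q} P≢Q = ∃-not-of-count (incident P) (incident Q)
    (≤-trans (s≤s (count-common-lines≤1 P≢Q))
             (≡.subst (2 ≤_) (≡.sym (count-lines-through P)) 1<r))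

  count-lines-meeting≤2 : ∀ {R P Q} → R ≢ P → R ≢ Q →
    count (λ ℓ → incident R ℓ ∧ (incident P ℓ ∨ incident Q ℓ)) ≤ 2
  count-lines-meeting≤2 {R} {P} {Q} R≢P R≢Q = begin
    count (λ ℓ → incident R ℓ ∧ (incident P ℓ ∨ incident Q ℓ))
      ≡⟨ count-cong (λ ℓ → ∧-distribˡ-∨ (incident R ℓ) (incident P ℓ) (incident Q ℓ)) ⟩
    count (λ ℓ → (incident R ℓ ∧ incident P ℓ) ∨ (incident R ℓ ∧ incident Q ℓ))
      ≤⟨ count-∨ (λ ℓ → incident R ℓ ∧ incident P ℓ) (λ ℓ → incident R ℓ ∧ incident Q ℓ) ⟩
    count (λ ℓ → incident R ℓ ∧ incident P ℓ) ℕ.+ count (λ ℓ → incident R ℓ ∧ incident Q ℓ)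
      ≤⟨ +-mono-≤ (count-common-lines≤1 R≢P) (count-common-lines≤1 R≢Q) ⟩
    2 ∎
    where open ≤-Reasoning

  line-through-avoiding-both : 2 < r → ∀ {R P Q} → R ≢ P → R ≢ Q →
    ∃ λ ℓ → T (incident R ℓ) × T (not (incident P ℓ ∨ incident Q ℓ))
  line-through-avoiding-both 2<r {R} {P} {Q} R≢P R≢Q =
    ∃-not-of-count (incident R) (λ ℓ → incident P ℓ ∨ incident Q ℓ)
      (≤-trans (s≤s (count-lines-meeting≤2 R≢P R≢Q))
               (≡.subst (3 ≤_) (≡.sym (count-lines-through R)) 2<r))

  two-points-on : 1 < k → ∀ ℓ → ∃₂ λ P Q → P ≢ Q × T (incident P ℓ) × T (incident Q ℓ)
  two-points-on 1<k ℓ =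
    let P , Pℓ = ∃-of-count (≤-trans (s≤s z≤n) count≥2)
        Q , Qℓ , Q≢P = ∃-not-of-count (λ X → incident X ℓ) (λ X → ⌊ X ≟ P ⌋)
                         (≤-trans (s≤s (count-≤1 only-P)) count≥2)
    in P , Q , (λ P≡Q → toWitnessFalse Q≢P (≡.sym P≡Q)) , Pℓ , Qℓ
    where
      count≥2 : 2 ≤ count (λ X → incident X ℓ)
      count≥2 = ≡.subst (2 ≤_) (≡.sym (count-points-on ℓ)) 1<k
      only-P : ∀ {P} X Y → T (incident X ℓ ∧ ⌊ X ≟ P ⌋) → T (incident Y ℓ ∧ ⌊ Y ≟ P ⌋) → X ≡ Y
      only-P X Y X≡P Y≡P = ≡.trans (toWitness (proj₂ (T-∧⁻ (incident X ℓ) X≡P)))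
                                   (≡.sym (toWitness (proj₂ (T-∧⁻ (incident Y ℓ) Y≡P))))

  allLines : LeviVertex v b → Bool
  allLines = [ const false , const true ]′

  pointAndAvoidingLines : Fin v → LeviVertex v b → Bool
  pointAndAvoidingLines P = [ (λ X → ⌊ X ≟ P ⌋) , (λ ℓ → not (incident P ℓ)) ]′

  pairAndAvoidingLines : Fin v → Fin v → LeviVertex v b → Bool
  pairAndAvoidingLines P Q =
    [ (λ X → ⌊ X ≟ P ⌋ ∨ ⌊ X ≟ Q ⌋) , (λ ℓ → not (incident P ℓ) ∧ not (incident Q ℓ)) ]′

  allLines-maximal : 0 < r → MaximalIndependent (Levi C) allLines
  allLines-maximal 0<r =
    levi-maximal _ _ (λ _ _ ()) (λ P _ → let ℓ , Pℓ = line-through 0<r P in ℓ , _ , Pℓ)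
                     (λ _ ℓ∉ → ⊥-elim (ℓ∉ _))

  pointAndAvoidingLines-maximal : 1 < r → ∀ P →
    MaximalIndependent (Levi C) (pointAndAvoidingLines P)
  pointAndAvoidingLines-maximal 1<r P = levi-maximal _ _ independent pointDom lineDom
    where
      independent : ∀ X ℓ → T ⌊ X ≟ P ⌋ → T (not (incident P ℓ)) → ¬ T (incident X ℓ)
      independent X ℓ X≡P P∉ℓ rewrite toWitness X≡P = T-not⇒¬T P∉ℓ
      pointDom : ∀ X → ¬ T ⌊ X ≟ P ⌋ → ∃ λ ℓ → T (not (incident P ℓ)) × T (incident X ℓ)
      pointDom X X≢P = let ℓ , Xℓ , P∉ℓ = line-through-avoiding 1<r (X≢P ∘ fromWitness) in
                       ℓ , P∉ℓ , Xℓ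
      lineDom : ∀ ℓ → ¬ T (not (incident P ℓ)) → ∃ λ X → T ⌊ X ≟ P ⌋ × T (incident X ℓ)
      lineDom ℓ P∈ℓ = P , fromWitness ≡.refl , ¬T-not⇒T P∈ℓ

  pairAndAvoidingLines-maximal : 2 < r → ∀ P Q →
    MaximalIndependent (Levi C) (pairAndAvoidingLines P Q)
  pairAndAvoidingLines-maximal 2<r P Q = levi-maximal _ _ independent pointDom lineDom
    where
      independent : ∀ X ℓ → T (⌊ X ≟ P ⌋ ∨ ⌊ X ≟ Q ⌋) →
        T (not (incident P ℓ) ∧ not (incident Q ℓ)) → ¬ T (incident X ℓ)
      independent X ℓ X∈ ℓ∈ with T-∨⁻ ⌊ X ≟ P ⌋ X∈ | T-∧⁻ (not (incident P ℓ)) ℓ∈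
      ... | inj₁ X≡P | P∉ℓ , _ rewrite toWitness X≡P = T-not⇒¬T P∉ℓ
      ... | inj₂ X≡Q | _ , Q∉ℓ rewrite toWitness X≡Q = T-not⇒¬T Q∉ℓ
      pointDom : ∀ X → ¬ T (⌊ X ≟ P ⌋ ∨ ⌊ X ≟ Q ⌋) →
        ∃ λ ℓ → T (not (incident P ℓ) ∧ not (incident Q ℓ)) × T (incident X ℓ)
      pointDom X X∉ =
        let ℓ , Xℓ , PQ∉ℓ = line-through-avoiding-both 2<r
                              (λ X≡P → X∉ (T-∨⁺ˡ ⌊ X ≟ Q ⌋ (fromWitness X≡P)))
                              (λ X≡Q → X∉ (T-∨⁺ʳ ⌊ X ≟ P ⌋ (fromWitness X≡Q)))
        in ℓ , ≡.subst T (not-∨ (incident P ℓ) (incident Q ℓ)) PQ∉ℓ , Xℓ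
      lineDom : ∀ ℓ → ¬ T (not (incident P ℓ) ∧ not (incident Q ℓ)) →
        ∃ λ X → T (⌊ X ≟ P ⌋ ∨ ⌊ X ≟ Q ⌋) × T (incident X ℓ)
      lineDom ℓ ℓ∉ with T-∨⁻ (incident P ℓ)
                          (¬T-not⇒T (ℓ∉ ∘ ≡.subst T (not-∨ (incident P ℓ) (incident Q ℓ))))
      ... | inj₁ Pℓ = P , T-∨⁺ˡ ⌊ P ≟ Q ⌋ (fromWitness ≡.refl) , Pℓ
      ... | inj₂ Qℓ = Q , T-∨⁺ʳ ⌊ Q ≟ P ⌋ (fromWitness ≡.refl) , Qℓ

module WellCovered {c ℓ′} {v b r k} (C : Configuration v b r k) (F : Field c ℓ′)
  (f : LeviVertex v b → Field.Carrier F) (wc : WellCoveredLevi F C f) where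
  open Configuration C
  open LeviGraph C
  open Field F
  open MonoidSum +-commutativeMonoid using (sum; sum-cong-≋; ∑-distrib-+)
  open Selection +-commutativeMonoid
  open GroupProperties +-group using (∙-cancelˡ; ∙-cancelʳ)
  open SetoidReasoning setoid

  f₁ : Fin v → Carrier
  f₁ = f ∘ inj₁

  f₂ : Fin b → Carrier
  f₂ = f ∘ inj₂

  sumFin≡sum : ∀ {n} (φ : Fin n → Carrier) → sumFin F φ ≡ sum φ
  sumFin≡sum {zero}  φ = ≡.refl
  sumFin≡sum {suc n} φ = ≡.cong (φ Fin.zero +_) (sumFin≡sum (φ ∘ Fin.suc))

  weight-split : ∀ sp sl → weightLevi F f [ sp , sl ]′ ≈
    sum (λ X → sel (sp X) (f₁ X)) + sum (λ ℓ → sel (sl ℓ) (f₂ ℓ))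
  weight-split sp sl = reflexive
    (≡.cong₂ _+_ (sumFin≡sum (λ X → sel (sp X) (f₁ X))) (sumFin≡sum (λ ℓ → sel (sl ℓ) (f₂ ℓ))))

  ∑-sel-≟ : ∀ P → sum (λ X → sel ⌊ X ≟ P ⌋ (f₁ X)) ≈ f₁ P
  ∑-sel-≟ P = ∑-sel-unique f₁ (fromWitness ≡.refl) (λ X → toWitness)

  weight-allLines : weightLevi F f allLines ≈ sum f₂
  weight-allLines = trans (weight-split _ _) (trans (+-congʳ (∑-zero {v} (λ _ → refl))) (+-identityˡ _))

  weight-pointAndAvoidingLines : ∀ P → weightLevi F f (pointAndAvoidingLines P) ≈
    f₁ P + sum (λ ℓ → sel (not (incident P ℓ)) (f₂ ℓ))
  weight-pointAndAvoidingLines P = trans (weight-split _ _) (+-congʳ (∑-sel-≟ P))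

  weight-pairAndAvoidingLines : ∀ {P Q} → P ≢ Q → weightLevi F f (pairAndAvoidingLines P Q) ≈
    (f₁ P + f₁ Q) + sum (λ ℓ → sel (not (incident P ℓ) ∧ not (incident Q ℓ)) (f₂ ℓ))
  weight-pairAndAvoidingLines {P} {Q} P≢Q = trans (weight-split _ _) (+-congʳ (begin
    sum (λ X → sel (⌊ X ≟ P ⌋ ∨ ⌊ X ≟ Q ⌋) (f₁ X))
      ≈⟨ sum-cong-≋ (λ X → sel-∨ ⌊ X ≟ P ⌋ ⌊ X ≟ Q ⌋ (f₁ X) (disjoint X)) ⟩
    sum (λ X → sel ⌊ X ≟ P ⌋ (f₁ X) + sel ⌊ X ≟ Q ⌋ (f₁ X))
      ≈⟨ ∑-distrib-+ (λ X → sel ⌊ X ≟ P ⌋ (f₁ X)) (λ X → sel ⌊ X ≟ Q ⌋ (f₁ X)) ⟩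
    sum (λ X → sel ⌊ X ≟ P ⌋ (f₁ X)) + sum (λ X → sel ⌊ X ≟ Q ⌋ (f₁ X))
      ≈⟨ +-cong (∑-sel-≟ P) (∑-sel-≟ Q) ⟩
    f₁ P + f₁ Q ∎))
    where
      disjoint : ∀ X → ¬ (T ⌊ X ≟ P ⌋ × T ⌊ X ≟ Q ⌋)
      disjoint X (X≡P , X≡Q) = P≢Q (≡.trans (≡.sym (toWitness X≡P)) (toWitness X≡Q))

  weight-point≈lines-through : 1 < r → ∀ P → f₁ P ≈ sum (λ ℓ → sel (incident P ℓ) (f₂ ℓ))
  weight-point≈lines-through 1<r P = ∙-cancelʳ avoiding (f₁ P) through (begin
    f₁ P + avoiding                              ≈⟨ weight-pointAndAvoidingLines P ⟨
    weightLevi F f (pointAndAvoidingLines P)     ≈⟨ wc _ _ (pointAndAvoidingLines-maximal 1<r P)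
                                                           (allLines-maximal (<⇒≤ 1<r)) ⟩
    weightLevi F f allLines                      ≈⟨ weight-allLines ⟩
    sum f₂                                       ≈⟨ ∑-sel-split (const true) (incident P) f₂ ⟩
    through + avoiding                           ∎)
    where
      through avoiding : Carrier
      through  = sum (λ ℓ → sel (incident P ℓ) (f₂ ℓ))
      avoiding = sum (λ ℓ → sel (not (incident P ℓ)) (f₂ ℓ))

  weight-point≈lines-avoiding : 2 < r → ∀ {P Q} → P ≢ Q →
    f₁ Q ≈ sum (λ ℓ → sel (not (incident P ℓ) ∧ incident Q ℓ) (f₂ ℓ))
  weight-point≈lines-avoiding 2<r {P} {Q} P≢Q = ∙-cancelʳ neither _ _ (∙-cancelˡ (f₁ P) _ _ (begin
    f₁ P + (f₁ Q + neither)                      ≈⟨ +-assoc (f₁ P) (f₁ Q) neither ⟨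
    (f₁ P + f₁ Q) + neither                      ≈⟨ weight-pairAndAvoidingLines P≢Q ⟨
    weightLevi F f (pairAndAvoidingLines P Q)    ≈⟨ wc _ _ (pairAndAvoidingLines-maximal 2<r P Q)
                                                   (pointAndAvoidingLines-maximal (<⇒≤ 2<r) P) ⟩
    weightLevi F f (pointAndAvoidingLines P)     ≈⟨ weight-pointAndAvoidingLines P ⟩
    f₁ P + sum (λ ℓ → sel (not (incident P ℓ)) (f₂ ℓ))
                                                 ≈⟨ +-congˡ (∑-sel-split (not ∘ incident P) (incident Q) f₂) ⟩
    f₁ P + (onlyQ + neither)                     ∎))
    where
      onlyQ neither : Carrier
      onlyQ   = sum (λ ℓ → sel (not (incident P ℓ) ∧ incident Q ℓ) (f₂ ℓ))
      neither = sum (λ ℓ → sel (not (incident P ℓ) ∧ not (incident Q ℓ)) (f₂ ℓ))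

  weight-line≈0 : 1 < k → 2 < r → ∀ ℓ → f₂ ℓ ≈ 0#
  weight-line≈0 1<k 2<r ℓ with two-points-on 1<k ℓ
  ... | P , Q , P≢Q , Pℓ , Qℓ = ∙-cancelʳ (f₁ Q) (f₂ ℓ) 0# (begin
    f₂ ℓ + f₁ Q                                  ≈⟨ +-cong (∑-sel-unique f₂ (T-∧⁺ Qℓ Pℓ) only-ℓ) avoidingP ⟨
    sum (λ m → sel (incident Q m ∧ incident P m) (f₂ m)) +
    sum (λ m → sel (incident Q m ∧ not (incident P m)) (f₂ m))
                                                 ≈⟨ ∑-sel-split (incident Q) (incident P) f₂ ⟨
    sum (λ m → sel (incident Q m) (f₂ m))        ≈⟨ weight-point≈lines-through (<⇒≤ 2<r) Q ⟨
    f₁ Q                                         ≈⟨ +-identityˡ (f₁ Q) ⟨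
    0# + f₁ Q                                    ∎)
    where
      only-ℓ : ∀ m → T (incident Q m ∧ incident P m) → m ≡ ℓ
      only-ℓ m QPm = let Qm , Pm = T-∧⁻ (incident Q m) QPm in
                     points-one-line Q P m ℓ (P≢Q ∘ ≡.sym) Qm Pm Qℓ Pℓ
      avoidingP : sum (λ m → sel (incident Q m ∧ not (incident P m)) (f₂ m)) ≈ f₁ Q
      avoidingP = sym (trans (weight-point≈lines-avoiding 2<r P≢Q) (sum-cong-≋ λ m →
        reflexive (≡.cong (λ c → sel c (f₂ m)) (∧-comm (not (incident P m)) (incident Q m)))))

  weight-point≈0 : 1 < k → 2 < r → ∀ P → f₁ P ≈ 0#
  weight-point≈0 1<k 2<r P = trans (weight-point≈lines-through (<⇒≤ 2<r) P)
    (∑-zero (λ ℓ → sel-zero (incident P ℓ) (weight-line≈0 1<k 2<r ℓ)))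

theorem1p7 : ∀ {c ℓ : Level} (v b r k : ℕ) → 4 ≤ v → 4 ≤ b → 2 ≤ k → 2 < r →
    (C : Configuration v b r k) → (F : Field c ℓ) → WcdimZeroLevi F C
theorem1p7 v b r k _ _ 1<k 2<r C F f wc (inj₁ P) = WellCovered.weight-point≈0 C F f wc 1<k 2<r P
theorem1p7 v b r k _ _ 1<k 2<r C F f wc (inj₂ ℓ) = WellCovered.weight-line≈0 C F f wc 1<k 2<r ℓ
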